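{- Let $t_x,t_y\ge 1$ be integers and let $A=B\cup C$ where $B=[0,t_x-1]\times[0,(t_y),t_y^2-t_y]$ and $C=[0,(t_x),t_x^2-t_x]\times[0,t_y-1]$. Then $|A|=2t_xt_y-1$ and $A+A\supseteq[0,t_x^2-1]\times[0,t_y^2-1]$.
   Context: For integers $m\le n$, $[m,n]$ denotes $\{m,\dots,n\}$. For integers $a\le b$ and $t\ge1$ with $t\mid b-a$, $[a,(t),b]=\{a,a+t,a+2t,\dots,b\}$. For sets of integer points, $A+A=\{(x+x',y+y'):(x,y),(x',y')\in A\}$. -}

module Defs where

open import Data.Nat using (ℕ; _+_; _*_; _∸_; _<_; _≟_)
open import Data.Product using (_×_; _,_; ∃-syntax; proj₁; proj₂)
open import Data.List using (List; map; upTo; cartesianProduct; _++_; deduplicate; length)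
open import Data.List.Membership.Propositional using (_∈_)
open import Data.Product.Properties using (≡-dec)
open import Relation.Binary.PropositionalEquality using (_≡_)

Point : Set
Point = ℕ × ℕ

interval0 : ℕ → List ℕ
interval0 n = upTo n

-- [0,(t),t*t - t] = {0, t, 2t, ..., t*t - t} = {t*j : 0 ≤ j ≤ t-1}
progression0 : ℕ → List ℕ
progression0 t = map (λ j → t * j) (upTo t)

_⊠_ : List ℕ → List ℕ → List Point
xs ⊠ ys = cartesianProduct xs ys

setB : ℕ → ℕ → List Point
setB tx ty = interval0 tx ⊠ progression0 ty

setC : ℕ → ℕ → List Point
setC tx ty = progression0 tx ⊠ interval0 ty

setA : ℕ → ℕ → List Point
setA tx ty = deduplicate (≡-dec _≟_ _≟_) (setB tx ty ++ setC tx ty)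

-- cardinality of a finite set given by a duplicate-free list
card : List Point → ℕ
card = length

addP : Point → Point → Point
addP (x , y) (x' , y') = (x + x' , y + y')

_∈Sumset_ : Point → List Point → Set
p ∈Sumset S = ∃[ a ] ∃[ b ] (a ∈ S × b ∈ S × p ≡ addP a b)

-- B and C meet only in the origin, and each has tx ty points, so |A| = 2 tx ty - 1.
-- Every x < t² is (x mod t) + t ⌊x / t⌋, an element of [0, t-1] plus one of [0,(t),t²-t];
-- hence (x , y) = (x mod tx , ty ⌊y / ty⌋) + (tx ⌊x / tx⌋ , y mod ty) with summands in B and C.
module Submission where

open import Defs
open import Data.Nat using (ℕ; _+_; _*_; _∸_; _<_; _≤_; zero; suc; NonZero; >-nonZero⁻¹; _≟_)
open import Data.Nat.Properties
open import Data.Nat.DivMod using (_/_; _%_; m≡m%n+[m/n]*n; m%n<n; m<n*o⇒m/o<n)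
open import Data.Product using (_×_; _,_; ∃-syntax)
open import Data.Product.Properties using (≡-dec)
open import Data.Sum using (inj₁; inj₂)
open import Data.List using (List; []; _∷_; drop; map; upTo; cartesianProduct; _++_; deduplicate; length)
open import Data.List.Properties using (length-map; length-++; length-upTo)
open import Data.List.Membership.Propositional using (_∈_)
open import Data.List.Membership.Propositional.Properties
open import Data.List.Membership.Propositional.Properties.WithK using (unique∧set⇒bag)
open import Data.List.Relation.Unary.Any using (here; there)
open import Data.List.Relation.Unary.AllPairs using (_∷_)
open import Data.List.Relation.Unary.All using (lookup)
open import Data.List.Relation.Unary.Unique.Propositional using (Unique)
import Data.List.Relation.Unary.Unique.Propositional.Properties as Unique
open import Data.List.Relation.Unary.Unique.DecPropositional.Properties using (deduplicate-!)
open import Data.List.Relation.Binary.BagAndSetEquality using (∼bag⇒↭)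
open import Data.List.Relation.Binary.Permutation.Propositional.Properties using (↭-length)
open import Relation.Binary.Definitions using (DecidableEquality)
open import Relation.Binary.PropositionalEquality
open import Relation.Nullary using (contradiction)
open import Function.Bundles using (mk⇔; _⇔_; Equivalence)

private
  variable
    A B : Set

length-cartesianProduct : (xs : List A) (ys : List B) →
  length (cartesianProduct xs ys) ≡ length xs * length ys
length-cartesianProduct []       ys = refl
length-cartesianProduct (x ∷ xs) ys = begin
  length (map (x ,_) ys ++ cartesianProduct xs ys)
    ≡⟨ length-++ (map (x ,_) ys) ⟩
  length (map (x ,_) ys) + length (cartesianProduct xs ys)
    ≡⟨ cong₂ _+_ (length-map (x ,_) ys) (length-cartesianProduct xs ys) ⟩
  length ys + length xs * length ys
    ∎
  where open ≡-Reasoning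

module _ (_≟ᴬ_ : DecidableEquality A) where

  length-deduplicate : ∀ {xs ys} → Unique ys → (∀ {z} → z ∈ xs ⇔ z ∈ ys) →
    length (deduplicate _≟ᴬ_ xs) ≡ length ys
  length-deduplicate {xs} ys! xs∼ys = ↭-length (∼bag⇒↭ (unique∧set⇒bag (deduplicate-! _≟ᴬ_ xs) ys! dedup∼ys))
    where
    dedup∼ys : ∀ {z} → z ∈ deduplicate _≟ᴬ_ xs ⇔ z ∈ _
    dedup∼ys = mk⇔ (λ z∈ → Equivalence.to xs∼ys (∈-deduplicate⁻ _≟ᴬ_ xs z∈))
                   (λ z∈ → ∈-deduplicate⁺ _≟ᴬ_ (Equivalence.from xs∼ys z∈))

  length-deduplicate-++-∷ : ∀ {xs c ys} → Unique xs → Unique (c ∷ ys) → c ∈ xs →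
    (∀ {v} → v ∈ xs → v ∈ c ∷ ys → v ≡ c) →
    length (deduplicate _≟ᴬ_ (xs ++ c ∷ ys)) ≡ length xs + length ys
  length-deduplicate-++-∷ {xs} {c} {ys} xs! (c∉ys ∷ ys!) c∈xs xs∩c∷ys⊆c = begin
    length (deduplicate _≟ᴬ_ (xs ++ c ∷ ys)) ≡⟨ length-deduplicate xs++ys! (mk⇔ drop-c restore-c) ⟩
    length (xs ++ ys)                        ≡⟨ length-++ xs ⟩
    length xs + length ys                    ∎
    where
    open ≡-Reasoning
    xs++ys! : Unique (xs ++ ys)
    xs++ys! = Unique.++⁺ xs! ys! λ (v∈xs , v∈ys) →
      lookup c∉ys v∈ys (sym (xs∩c∷ys⊆c v∈xs (there v∈ys)))
    drop-c : ∀ {z} → z ∈ xs ++ c ∷ ys → z ∈ xs ++ ys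
    drop-c z∈ with ∈-++⁻ xs z∈
    ... | inj₁ z∈xs          = ∈-++⁺ˡ z∈xs
    ... | inj₂ (here refl)   = ∈-++⁺ˡ c∈xs
    ... | inj₂ (there z∈ys)  = ∈-++⁺ʳ xs z∈ys
    restore-c : ∀ {z} → z ∈ xs ++ ys → z ∈ xs ++ c ∷ ys
    restore-c z∈ with ∈-++⁻ xs z∈
    ... | inj₁ z∈xs = ∈-++⁺ˡ z∈xs
    ... | inj₂ z∈ys = ∈-++⁺ʳ xs (there z∈ys)

∈-progression0⁺ : ∀ {t j} → j < t → t * j ∈ progression0 t
∈-progression0⁺ j<t = ∈-map⁺ _ (∈-upTo⁺ j<t)

∈-progression0⁻ : ∀ {t x} → x ∈ progression0 t → ∃[ j ] (j < t × x ≡ t * j)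
∈-progression0⁻ {t} x∈ with ∈-map⁻ (t *_) x∈
... | j , j∈ , x≡tj = j , ∈-upTo⁻ j∈ , x≡tj

progression0-unique : ∀ t .{{_ : NonZero t}} → Unique (progression0 t)
progression0-unique t = Unique.map⁺ (*-cancelˡ-≡ _ _ t) (Unique.upTo⁺ t)

length-progression0 : ∀ t → length (progression0 t) ≡ t
length-progression0 t = trans (length-map (t *_) (upTo t)) (length-upTo t)

interval0∩progression0⊆0 : ∀ {t x} → x ∈ interval0 t → x ∈ progression0 t → x ≡ 0
interval0∩progression0⊆0 {t} x∈interval x∈progression with ∈-progression0⁻ x∈progression
... | zero  , _ , refl = *-zeroʳ t
... | suc j , _ , refl = contradiction (∈-upTo⁻ x∈interval) (≤⇒≯ (m≤m*n t (suc j)))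

interval0+progression0-covers-square : ∀ {t x} .{{_ : NonZero t}} → x < t * t →
  ∃[ a ] ∃[ b ] (a ∈ interval0 t × b ∈ progression0 t × x ≡ a + b)
interval0+progression0-covers-square {t} {x} x<t² =
  x % t , t * (x / t) , ∈-upTo⁺ (m%n<n x t) , ∈-progression0⁺ (m<n*o⇒m/o<n x<t²) ,
  trans (m≡m%n+[m/n]*n x t) (cong (x % t +_) (*-comm (x / t) t))

setB-unique : ∀ tx ty .{{_ : NonZero ty}} → Unique (setB tx ty)
setB-unique tx ty = Unique.cartesianProduct⁺ (Unique.upTo⁺ tx) (progression0-unique ty)

setC-unique : ∀ tx ty .{{_ : NonZero tx}} → Unique (setC tx ty)
setC-unique tx ty = Unique.cartesianProduct⁺ (progression0-unique tx) (Unique.upTo⁺ ty)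

length-setB : ∀ tx ty → length (setB tx ty) ≡ tx * ty
length-setB tx ty = trans (length-cartesianProduct (upTo tx) (progression0 ty))
  (cong₂ _*_ (length-upTo tx) (length-progression0 ty))

length-setC : ∀ tx ty → length (setC tx ty) ≡ tx * ty
length-setC tx ty = trans (length-cartesianProduct (progression0 tx) (upTo ty))
  (cong₂ _*_ (length-progression0 tx) (length-upTo ty))

origin∈setB : ∀ tx ty .{{_ : NonZero tx}} .{{_ : NonZero ty}} → (0 , 0) ∈ setB tx ty
origin∈setB tx ty = ∈-cartesianProduct⁺ (∈-upTo⁺ (>-nonZero⁻¹ tx))
  (subst (_∈ progression0 ty) (*-zeroʳ ty) (∈-progression0⁺ (>-nonZero⁻¹ ty)))

setB∩setC⊆origin : ∀ {tx ty p} → p ∈ setB tx ty → p ∈ setC tx ty → p ≡ (0 , 0)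
setB∩setC⊆origin {tx} {ty} p∈B p∈C
  with ∈-cartesianProduct⁻ (upTo tx) (progression0 ty) p∈B
     | ∈-cartesianProduct⁻ (progression0 tx) (upTo ty) p∈C
... | x∈interval , y∈progression | x∈progression , y∈interval =
  cong₂ _,_ (interval0∩progression0⊆0 x∈interval x∈progression)
            (interval0∩progression0⊆0 y∈interval y∈progression)

n+m≡2n∸1 : ∀ {m n} → suc m ≡ n → n + m ≡ 2 * n ∸ 1
n+m≡2n∸1 {m} refl = begin
  suc m + m          ≡⟨ +-suc m m ⟨
  m + suc m          ≡⟨ cong (λ k → m + suc k) (+-identityʳ m) ⟨
  2 * suc m ∸ 1      ∎
  where open ≡-Reasoning

card-setA : ∀ k m → card (setA (suc k) (suc m)) ≡ 2 * suc k * suc m ∸ 1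
card-setA k m = begin
  card (setA tx ty)
    ≡⟨ length-deduplicate-++-∷ (≡-dec _≟_ _≟_) {ys = setC⁻}
         (setB-unique tx ty) (setC-unique tx ty) corner∈setB setB∩setC⊆corner ⟩
  length (setB tx ty) + length setC⁻  ≡⟨ cong (_+ length setC⁻) (length-setB tx ty) ⟩
  tx * ty + length setC⁻              ≡⟨ n+m≡2n∸1 (length-setC tx ty) ⟩
  2 * (tx * ty) ∸ 1                   ≡⟨ cong (_∸ 1) (*-assoc 2 tx ty) ⟨
  2 * tx * ty ∸ 1                     ∎
  where
  open ≡-Reasoning
  tx = suc k
  ty = suc m
  -- setC tx ty unfolds to (tx * 0 , 0) ∷ setC⁻, so that head, not (0 , 0), is the common point.
  setC⁻ : List Point
  setC⁻ = drop 1 (setC tx ty)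
  origin≡corner : (0 , 0) ≡ (tx * 0 , 0)
  origin≡corner = cong (_, 0) (sym (*-zeroʳ tx))
  corner∈setB : (tx * 0 , 0) ∈ setB tx ty
  corner∈setB = subst (_∈ setB tx ty) origin≡corner (origin∈setB tx ty)
  setB∩setC⊆corner : ∀ {p} → p ∈ setB tx ty → p ∈ setC tx ty → p ≡ (tx * 0 , 0)
  setB∩setC⊆corner p∈B p∈C = trans (setB∩setC⊆origin {tx} {ty} p∈B p∈C) origin≡corner

square⊆setA+setA : ∀ tx ty .{{_ : NonZero tx}} .{{_ : NonZero ty}} {x y} →
  x < tx * tx → y < ty * ty → (x , y) ∈Sumset setA tx ty
square⊆setA+setA tx ty x<tx² y<ty² with interval0+progression0-covers-square x<tx²
                                      | interval0+progression0-covers-square y<ty²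
... | a , b , a∈interval , b∈progression , x≡a+b | c , d , c∈interval , d∈progression , y≡c+d =
  (a , d) , (b , c) ,
  ∈-setA (∈-++⁺ˡ (∈-cartesianProduct⁺ a∈interval d∈progression)) ,
  ∈-setA (∈-++⁺ʳ (setB tx ty) (∈-cartesianProduct⁺ b∈progression c∈interval)) ,
  cong₂ _,_ x≡a+b (trans y≡c+d (+-comm c d))
  where
  ∈-setA : ∀ {p} → p ∈ setB tx ty ++ setC tx ty → p ∈ setA tx ty
  ∈-setA = ∈-deduplicate⁺ (≡-dec _≟_ _≟_)

theorem6 : (tx ty : ℕ) → 1 ≤ tx → 1 ≤ ty →
    (card (setA tx ty) ≡ 2 * tx * ty ∸ 1)
    × ((x y : ℕ) → x < tx * tx → y < ty * ty → (x , y) ∈Sumset setA tx ty)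
theorem6 (suc k) (suc m) _ _ = card-setA k m , λ x y → square⊆setA+setA (suc k) (suc m)
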